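{- Let $g$ be a global state, $p,q\in\mathcal{PV}$ and $\Gamma\subseteq\mathcal{A}$. If $\phi\in\{\langle\langle\Gamma\rangle\rangle\mathrm{X}\,p,\ \langle\langle\Gamma\rangle\rangle\mathrm{G}\,p,\ \langle\langle\Gamma\rangle\rangle\,p\,\mathrm{U}\,q\}$, then the predicate $Model_{g,\phi}(\mathcal{V}_M)$ is negative monotonic with respect to $TB_i$ for $i\in\mathcal{A}\setminus\Gamma$.
   Context: Fix a set of agents $\mathcal{A}=\{1,\dots,n\}$, a finite set $\mathcal{PV}$ of propositional variables, and for each agent $i$ a finite set of local states $L_i=\{l_i^1,\dots,l_i^{n_i}\}$. Agent $i$ has actions $Act_i=\{a_i^1,\dots,a_i^{n_i}\}$ and a local protocol $P_i:L_i\to 2^{Act_i}$ with $P_i(l)\neq\emptyset$ for all $l$; its local transition function is $T_i(l_i^k,a_i^j)=l_i^j$, defined iff $a_i^j\in P_i(l_i^k)$. A model is $M=(St,T,V)$ with $St=L_1\times\dots\times L_n$, global actions $Act=Act_1\times\dots\times Act_n$, global transition $T(g,a)=g'$ iff $T_i(g^i,a^i)=g'^i$ for all $i$ (superscript $i$ denotes the $i$-th component), and valuation $V:St\to 2^{\mathcal{PV}}$. Encoding: $P_i$ is a Boolean $n_i\times n_i$ table (entry $(l,a)$ is $1$ iff $a\in P_i(l)$) flattened into $tb_i$; $V$ is a bit vector $vb$ of length $|St|\cdot|\mathcal{PV}|$ (entry $(g,p)$ is $1$ iff $p\in V(g)$). The model is encoded by $v_M=(tb_1,\dots,tb_n,vb)$;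 $\mathcal{V}_M=(TB_1,\dots,TB_n,VB)$ is the corresponding vector of Boolean variables; only vectors encoding models (each local state has at least one available action, i.e. each row of each table contains a $1$) are considered. A path from $g$ is $g_0a_0g_1a_1\dots$ with $g_0=g$, $T(g_k,a_k)=g_{k+1}$; $\pi[k]=g_k$. A strategy of agent $i$ is $\sigma_i:St\to Act_i$ with $\sigma_i(g)\in P_i(g^i)$; a joint strategy $\sigma_\Gamma$ is a tuple of strategies of agents in $\Gamma$; $out_M(g,\sigma_\Gamma)$ is the set of paths from $g$ with $a_k^j=\sigma_j(g_k)$ for all $k$ and $j\in\Gamma$. $M,g\models\langle\langle\Gamma\rangle\rangle\mathrm{X}\varphi$ iff there is $\sigma_\Gamma$ with $out_M(g,\sigma_\Gamma)\neq\emptyset$ and $M,\pi[1]\models\varphi$ for every $\pi$ in it; $M,g\models\langle\langle\Gamma\rangle\rangle\varphi_1\mathrm{U}\varphi_2$ iff there is $\sigma_\Gamma$ with nonempty outcome such that every $\pi$ in it has $i\ge0$ with $M,\pi[i]\models\varphi_2$ and $M,\pi[j]\models\varphi_1$ for $j<i$; $M,g\models\langle\langle\Gamma\rangle\rangle\mathrm{G}\varphi$ iff there is $\sigma_\Gamma$ with nonempty outcome such that $M,\pi[i]\models\varphi$ for all $i\ge 0$ and all $\pi$ in it; $M,g\models p$ iff $p\in V(g)$. $Model_{g,\phi}(v_M)=1$ iff $M,g\models\phi$ for the model $M$ encoded by $v_M$. A predicate on bit vectors is negative monotonic w.r.t. a set $W$ of its variables if changing any single variable of $W$ from $1$ to $0$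 (others fixed, staying within the considered vectors) preserves the value $1$. -}

module Defs where

open import Data.Nat using (ℕ; zero; suc; _<_)
open import Data.Fin using (Fin)
open import Data.Fin.Subset using (Subset; _∈_; _∉_)
open import Data.Bool using (Bool; true; false)
open import Data.Product using (Σ; ∃; _×_; _,_)
open import Relation.Binary.PropositionalEquality using (_≡_; _≢_)

-- n agents (indexed by Fin n); agent i has ns i local states and ns i actions
-- (action a_i^j is identified with index j : Fin (ns i)); m propositional variables.
module _ {n : ℕ} (ns : Fin n → ℕ) where

  St : Set
  St = (i : Fin n) → Fin (ns i)

  Act : Set
  Act = (i : Fin n) → Fin (ns i)

-- The encoding v_M = (tb_1, …, tb_n, vb) of a model.
-- tb i l a = true  iff  a_i^a ∈ P_i(l_i^l);  vb g p = true iff p ∈ V(g).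
record Encoding {n : ℕ} (ns : Fin n → ℕ) (m : ℕ) : Set where
  constructor enc
  field
    tb : (i : Fin n) → Fin (ns i) → Fin (ns i) → Bool
    vb : St ns → Fin m → Bool
open Encoding public

-- Only vectors encoding models are considered: every row of every table contains a 1.
IsModel : ∀ {n m} {ns : Fin n → ℕ} → Encoding ns m → Set
IsModel {n} {m} {ns} v = (i : Fin n) (l : Fin (ns i)) → ∃ λ a → tb v i l a ≡ true

module _ {n m : ℕ} {ns : Fin n → ℕ} (v : Encoding ns m) where

  -- Global transition: T(g, a) = g'  iff  for all i, a^i ∈ P_i(g^i) and g'^i = l_i^{a^i}
  -- (since T_i(l_i^k, a_i^j) = l_i^j).
  Trans : St ns → Act ns → St ns → Set
  Trans g a g' = (i : Fin n) → (tb v i (g i) (a i) ≡ true) × (g' i ≡ a i)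

  record Path (g : St ns) : Set where
    field
      state  : ℕ → St ns
      action : ℕ → Act ns
      start  : state zero ≡ g
      step   : (k : ℕ) → Trans (state k) (action k) (state (suc k))
  open Path public

  record JointStrategy (Γ : Subset n) : Set where
    field
      σ     : (i : Fin n) → i ∈ Γ → St ns → Fin (ns i)
      legal : (i : Fin n) (h : i ∈ Γ) (g : St ns) → tb v i (g i) (σ i h g) ≡ true
  open JointStrategy public

  InOut : {Γ : Subset n} {g : St ns} → JointStrategy Γ → Path g → Set
  InOut {Γ} s π = (k : ℕ) (i : Fin n) (h : i ∈ Γ) → action π k i ≡ σ s i h (state π k)

  Holds : St ns → Fin m → Set
  Holds g p = vb v g p ≡ true

  Strat : Subset n → St ns → ({g : St ns} → Path g → Set) → Set
  Strat Γ g Φ = Σ (JointStrategy Γ) λ s →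
                  (Σ (Path g) λ π → InOut s π) ×
                  ((π : Path g) → InOut s π → Φ π)

data Formula (n m : ℕ) : Set where
  ⟪_⟫X_   : Subset n → Fin m → Formula n m
  ⟪_⟫G_   : Subset n → Fin m → Formula n m
  ⟪_⟫_U_  : Subset n → Fin m → Fin m → Formula n m

coalition : ∀ {n m} → Formula n m → Subset n
coalition (⟪ Γ ⟫X p)    = Γ
coalition (⟪ Γ ⟫G p)    = Γ
coalition (⟪ Γ ⟫ p U q) = Γ

Model : ∀ {n m} {ns : Fin n → ℕ} → St ns → Formula n m → Encoding ns m → Set
Model g (⟪ Γ ⟫X p) v =
  Strat v Γ g λ π → Holds v (Path.state π 1) p
Model g (⟪ Γ ⟫G p) v =
  Strat v Γ g λ π → (i : ℕ) → Holds v (Path.state π i) p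
Model g (⟪ Γ ⟫ p U q) v =
  Strat v Γ g λ π → ∃ λ i → Holds v (Path.state π i) q ×
                            ((j : ℕ) → j < i → Holds v (Path.state π j) p)

FlipDown : ∀ {n m} {ns : Fin n → ℕ} (i : Fin n) (l a : Fin (ns i)) →
           Encoding ns m → Encoding ns m → Set
FlipDown {n} {m} {ns} i l a v v' =
  (tb v i l a ≡ true) × (tb v' i l a ≡ false) ×
  ((l' a' : Fin (ns i)) → (l' , a') ≢ (l , a) → tb v' i l' a' ≡ tb v i l' a') ×
  ((j : Fin n) → j ≢ i → (l' a' : Fin (ns j)) → tb v' j l' a' ≡ tb v j l' a') ×
  ((g : St ns) (p : Fin m) → vb v' g p ≡ vb v g p)

NegMonotonicTB : ∀ {n m} {ns : Fin n → ℕ} → (Encoding ns m → Set) → Fin n → Set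
NegMonotonicTB {n} {m} {ns} P i =
  (l a : Fin (ns i)) (v v' : Encoding ns m) →
  IsModel v → IsModel v' → FlipDown i l a v v' → P v → P v'

module Submission where

open import Defs
open import Data.Nat using (ℕ; zero; suc)
open import Data.Fin using (Fin)
open import Data.Fin.Properties using (_≟_)
open import Data.Fin.Subset using (Subset; _∈_; _∉_)
open import Data.Fin.Subset.Properties using (_∈?_)
open import Data.Vec.Properties.WithK using ([]=-irrelevant)
open import Data.Bool using (true)
open import Data.Product using (Σ; _,_; proj₁; proj₂)
open import Data.Product.Properties using (,-injectiveˡ; ,-injectiveʳ)
open import Data.Empty using (⊥-elim)
open import Function using (_∘_)
open import Relation.Nullary using (yes; no)
open import Relation.Binary.PropositionalEquality
  using (_≡_; refl; sym; trans; cong)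

-- Removing an action of an agent outside Γ only removes transitions, so every path of
-- the new model is a path of the old one, while Γ keeps all its strategies.  A winning
-- strategy for Γ therefore stays winning; its outcome stays nonempty because every
-- local state of the new model still has an available action.

module _ {n m : ℕ} {ns : Fin n → ℕ} where

  record RestrictsOpponents (Γ : Subset n) (v v' : Encoding ns m) : Set where
    field
      protocol-⊆  : ∀ j (x y : Fin (ns j)) → tb v' j x y ≡ true → tb v j x y ≡ true
      coalition-⊇ : ∀ j → j ∈ Γ → ∀ (x y : Fin (ns j)) →
                    tb v j x y ≡ true → tb v' j x y ≡ true
      valuation-⊆ : ∀ g p → Holds v g p → Holds v' g p

  flipDown⇒restrictsOpponents : ∀ {Γ i} {l a : Fin (ns i)} {v v' : Encoding ns m} →
    i ∉ Γ → FlipDown i l a v v' → RestrictsOpponents Γ v v'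
  flipDown⇒restrictsOpponents {Γ} {i} {l} {a} {v} {v'} i∉Γ
                              (_ , flipped , same-row , same-agent , same-vb) =
    record { protocol-⊆ = protocol-⊆ ; coalition-⊇ = coalition-⊇ ; valuation-⊆ = valuation-⊆ }
    where
    protocol-⊆ : ∀ j (x y : Fin (ns j)) → tb v' j x y ≡ true → tb v j x y ≡ true
    protocol-⊆ j x y e with j ≟ i
    ... | no j≢i = trans (sym (same-agent j j≢i x y)) e
    ... | yes refl with x ≟ l | y ≟ a
    ...   | yes refl | yes refl with () ← trans (sym flipped) e
    ...   | no x≢l   | _        = trans (sym (same-row x y (x≢l ∘ ,-injectiveˡ))) e
    ...   | yes refl | no y≢a   = trans (sym (same-row x y (y≢a ∘ ,-injectiveʳ))) e
    coalition-⊇ : ∀ j → j ∈ Γ → ∀ (x y : Fin (ns j)) → tb v j x y ≡ true → tb v' j x y ≡ true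
    coalition-⊇ j j∈Γ x y e with j ≟ i
    ... | yes refl = ⊥-elim (i∉Γ j∈Γ)
    ... | no j≢i   = trans (same-agent j j≢i x y) e
    valuation-⊆ : ∀ g p → Holds v g p → Holds v' g p
    valuation-⊆ g p e = trans (same-vb g p) e

  module _ {v : Encoding ns m} {Γ : Subset n} (model : IsModel v) (s : JointStrategy v Γ) where

    completion : St ns → Act ns
    completion h j with j ∈? Γ
    ... | yes j∈Γ = σ s j j∈Γ h
    ... | no  _   = proj₁ (model j (h j))

    completion-legal : ∀ h j → tb v j (h j) (completion h j) ≡ true
    completion-legal h j with j ∈? Γ
    ... | yes j∈Γ = legal s j j∈Γ h
    ... | no  _   = proj₂ (model j (h j))

    completion-follows : ∀ h j (j∈Γ : j ∈ Γ) → completion h j ≡ σ s j j∈Γ h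
    completion-follows h j j∈Γ with j ∈? Γ
    ... | yes j∈Γ′ = cong (λ p → σ s j p h) ([]=-irrelevant j∈Γ′ j∈Γ)
    ... | no  j∉Γ  = ⊥-elim (j∉Γ j∈Γ)

    outcome-nonempty : ∀ g → Σ (Path v g) (InOut v s)
    outcome-nonempty g = π , λ k → completion-follows (iterate k)
      where
      iterate : ℕ → St ns
      iterate zero    = g
      iterate (suc k) = completion (iterate k)
      π : Path v g
      π = record { state = iterate ; action = completion ∘ iterate ; start = refl
                 ; step = λ k j → completion-legal (iterate k) j , refl }

  module _ {Γ : Subset n} {v v' : Encoding ns m} (R : RestrictsOpponents Γ v v') where
    open RestrictsOpponents R

    unrestrictPath : ∀ {g} → Path v' g → Path v g
    unrestrictPath π = record
      { state = state π ; action = action π ; start = start π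
      ; step  = λ k j → protocol-⊆ j _ _ (proj₁ (step π k j)) , proj₂ (step π k j) }

    restrictStrategy : JointStrategy v Γ → JointStrategy v' Γ
    restrictStrategy s = record
      { σ = σ s ; legal = λ j j∈Γ h → coalition-⊇ j j∈Γ _ _ (legal s j j∈Γ h) }

    Strat-restrict : ∀ {g} {Φ : {h : St ns} → Path v h → Set} {Φ' : {h : St ns} → Path v' h → Set} →
      IsModel v' → (∀ {h} (π : Path v' h) → Φ (unrestrictPath π) → Φ' π) →
      Strat v Γ g Φ → Strat v' Γ g Φ'
    Strat-restrict {g} model' Φ⇒Φ' (s , _ , wins) =
      restrictStrategy s , outcome-nonempty model' (restrictStrategy s) g ,
      λ π π∈out → Φ⇒Φ' π (wins (unrestrictPath π) π∈out)

  Model-restrict : ∀ {g} (φ : Formula n m) {v v' : Encoding ns m} →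
    RestrictsOpponents (coalition φ) v v' → IsModel v' → Model g φ v → Model g φ v'
  Model-restrict (⟪ _ ⟫X p) R model' =
    Strat-restrict R model' λ _ holds → valuation-⊆ _ p holds
    where open RestrictsOpponents R
  Model-restrict (⟪ _ ⟫G p) R model' =
    Strat-restrict R model' λ _ always k → valuation-⊆ _ p (always k)
    where open RestrictsOpponents R
  Model-restrict (⟪ _ ⟫ p U q) R model' =
    Strat-restrict R model' λ { _ (k , q-at-k , p-before) →
      k , valuation-⊆ _ q q-at-k , λ j j<k → valuation-⊆ _ p (p-before j j<k) }
    where open RestrictsOpponents R

theorem3p7 : {n m : ℕ} {ns : Fin n → ℕ} (g : St ns) (φ : Formula n m)
             (i : Fin n) → i ∉ coalition φ →
             NegMonotonicTB (Model g φ) i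
theorem3p7 g φ i i∉Γ l a v v' _ model' flip =
  Model-restrict φ (flipDown⇒restrictsOpponents i∉Γ flip) model'
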